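{- Let $G$ be a divisible design graph with parameters $(v,k,\lambda_1,\lambda_2,m,n)$ with $n$ odd, and suppose its canonical partition is equitable with quotient matrix $R=(r_{ij})$. Then $r_{ii}$ is even for all $i=1,\dots,m$.
   Context: A divisible design graph (DDG) with parameters $(v,k,\lambda_1,\lambda_2,m,n)$ is a $k$-regular graph on $v=mn$ vertices whose vertex set can be partitioned into $m$ classes $V_1,\dots,V_m$ of size $n$ (a canonical partition) such that any two distinct vertices in the same class have exactly $\lambda_1$ common neighbours and any two vertices in different classes have exactly $\lambda_2$ common neighbours. The partition is equitable with quotient matrix $R=(r_{ij})$ if every vertex of $V_i$ has exactly $r_{ij}$ neighbours in $V_j$ (this always holds for a DDG with $m>1$, $n>1$, $\lambda_1\neq\lambda_2$). -}

module Defs where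

open import Data.Nat using (ℕ; zero; suc; _+_; _*_)
open import Data.Bool using (Bool; true; false; _∧_; if_then_else_)
open import Data.Fin using (Fin; zero; suc)
open import Data.Fin.Properties using (_≟_)
open import Relation.Nullary.Decidable using (⌊_⌋)
open import Relation.Binary.PropositionalEquality using (_≡_; _≢_)
open import Data.Product using (_×_)

count : {v : ℕ} → (Fin v → Bool) → ℕ
count {zero} p = 0
count {suc v} p = (if p zero then 1 else 0) + count {v} (λ i → p (suc i))

record Graph (v : ℕ) : Set where
  field
    adj   : Fin v → Fin v → Bool
    sym   : ∀ x y → adj x y ≡ adj y x
    irrefl : ∀ x → adj x x ≡ false

open Graph public

_==_ : {k : ℕ} → Fin k → Fin k → Bool
i == j = ⌊ i ≟ j ⌋

degree : {v : ℕ} → Graph v → Fin v → ℕ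
degree G x = count (λ w → adj G x w)

commonNeighbours : {v : ℕ} → Graph v → Fin v → Fin v → ℕ
commonNeighbours G x y = count (λ w → adj G x w ∧ adj G y w)

-- G is a divisible design graph with parameters (v,k,λ₁,λ₂,m,n),
-- v = m n, with canonical partition given by the class map cls : Fin v → Fin m
-- (class V_i = cls⁻¹(i), each of size n).
record IsDDG {v : ℕ} (G : Graph v) (k λ₁ λ₂ m n : ℕ) (cls : Fin v → Fin m) : Set where
  field
    v≡mn      : v ≡ m * n
    regular   : ∀ x → degree G x ≡ k
    classSize : ∀ (i : Fin m) → count (λ w → cls w == i) ≡ n
    sameClass : ∀ x y → x ≢ y → cls x ≡ cls y → commonNeighbours G x y ≡ λ₁
    diffClass : ∀ x y → cls x ≢ cls y → commonNeighbours G x y ≡ λ₂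

IsEquitable : {v m : ℕ} → Graph v → (Fin v → Fin m) → (Fin m → Fin m → ℕ) → Set
IsEquitable G cls R = ∀ x j → count (λ w → adj G x w ∧ (cls w == j)) ≡ R (cls x) j

{-# OPTIONS --safe #-}
-- Let Gᵢ be the subgraph induced on the class Vᵢ. Equitability makes Gᵢ regular of
-- degree rᵢᵢ on n vertices, so by the handshake lemma n · rᵢᵢ = 2 |E(Gᵢ)| is even;
-- since n is odd and 2 is prime, rᵢᵢ is even.
module Submission where

open import Defs
open import Data.Nat using (ℕ; zero; suc; _+_; _*_)
open import Data.Nat.Properties using (+-assoc; +-identityʳ; *-identityʳ; *-comm; +-0-commutativeMonoid)
open import Data.Nat.Divisibility using (_∣_; divides; _∣0; ∣m∣n⇒∣m+n)
open import Data.Nat.Primality using (prime?; euclidsLemma)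
open import Data.Fin using (Fin; zero; suc)
open import Data.Fin.Properties using (_≟_)
open import Data.Bool using (Bool; true; false; _∧_; if_then_else_)
open import Data.Bool.Properties using (∧-zeroʳ)
open import Data.Sum using (inj₁; inj₂)
open import Relation.Nullary using (¬_; yes; no; contradiction)
open import Relation.Nullary.Decidable using (from-yes)
open import Relation.Binary.PropositionalEquality
  using (_≡_; refl; cong; cong₂; trans; subst; module ≡-Reasoning)
  renaming (sym to ≡-sym)
open import Algebra.Properties.CommutativeMonoid.Sum +-0-commutativeMonoid
  using (sum; sum-cong-≗; ∑-distrib-+)

private
  variable
    v : ℕ

count-cong : (p q : Fin v → Bool) → (∀ x → p x ≡ q x) → count p ≡ count q
count-cong {zero}  p q p≗q = refl
count-cong {suc v} p q p≗q = cong₂ (λ b c → (if b then 1 else 0) + c)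
  (p≗q zero) (count-cong (λ x → p (suc x)) (λ x → q (suc x)) (λ x → p≗q (suc x)))

count-false : count {v} (λ _ → false) ≡ 0
count-false {zero}  = refl
count-false {suc v} = count-false {v}

sum-if : (p : Fin v → Bool) (c : ℕ) → sum (λ x → if p x then c else 0) ≡ count p * c
sum-if {zero}  p c = refl
sum-if {suc v} p c with p zero
... | true  = cong (c +_) (sum-if (λ x → p (suc x)) c)
... | false = sum-if (λ x → p (suc x)) c

∧-swap-outer : ∀ a b c → a ∧ (b ∧ c) ≡ c ∧ (b ∧ a)
∧-swap-outer true  b true  = refl
∧-swap-outer true  b false = ∧-zeroʳ b
∧-swap-outer false b true  = ≡-sym (∧-zeroʳ b)
∧-swap-outer false b false = refl

induced : Graph v → (Fin v → Bool) → Graph v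
induced G P = record
  { adj    = λ x y → P x ∧ (adj G x y ∧ P y)
  ; sym    = λ x y → subst (λ b → P x ∧ (adj G x y ∧ P y) ≡ P y ∧ (b ∧ P x))
                           (Graph.sym G x y) (∧-swap-outer (P x) (adj G x y) (P y))
  ; irrefl = λ x → subst (λ b → P x ∧ (b ∧ P x) ≡ false)
                         (≡-sym (irrefl G x)) (∧-zeroʳ (P x))
  }

deleteFirstVertex : Graph (suc v) → Graph v
deleteFirstVertex G = record
  { adj    = λ x y → adj G (suc x) (suc y)
  ; sym    = λ x y → Graph.sym G (suc x) (suc y)
  ; irrefl = λ x → irrefl G (suc x)
  }

-- Every edge at the first vertex is counted once from each of its ends.
sum-degree-suc : (G : Graph (suc v)) →
  sum (degree G) ≡ (degree G zero + degree G zero) + sum (degree (deleteFirstVertex G))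
sum-degree-suc G = begin
  sum (degree G)
    ≡⟨⟩
  d + sum (λ x → toℕ (adj G (suc x) zero) + degree G⁻ x)
    ≡⟨ cong (d +_) (∑-distrib-+ (λ x → toℕ (adj G (suc x) zero)) (degree G⁻)) ⟩
  d + (sum (λ x → toℕ (adj G (suc x) zero)) + sum (degree G⁻))
    ≡⟨ cong (λ e → d + (e + sum (degree G⁻))) backEdges ⟩
  d + (d + sum (degree G⁻))
    ≡⟨ ≡-sym (+-assoc d d _) ⟩
  (d + d) + sum (degree G⁻) ∎
  where
  open ≡-Reasoning
  G⁻ = deleteFirstVertex G
  d = degree G zero
  toℕ : Bool → ℕ
  toℕ b = if b then 1 else 0
  backEdges : sum (λ x → toℕ (adj G (suc x) zero)) ≡ d
  backEdges = begin
    sum (λ x → toℕ (adj G (suc x) zero))  ≡⟨ sum-if (λ x → adj G (suc x) zero) 1 ⟩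
    count (λ x → adj G (suc x) zero) * 1   ≡⟨ *-identityʳ _ ⟩
    count (λ x → adj G (suc x) zero)       ≡⟨ count-cong _ _ (λ x → Graph.sym G (suc x) zero) ⟩
    count (λ x → adj G zero (suc x))
      ≡⟨ cong (λ b → toℕ b + count (λ x → adj G zero (suc x))) (≡-sym (irrefl G zero)) ⟩
    d                                      ∎

2∣n+n : ∀ n → 2 ∣ n + n
2∣n+n n = divides n (trans (cong (n +_) (≡-sym (+-identityʳ n))) (*-comm 2 n))

handshake : (G : Graph v) → 2 ∣ sum (degree G)
handshake {zero}  G = 2 ∣0
handshake {suc v} G = subst (2 ∣_) (≡-sym (sum-degree-suc G))
  (∣m∣n⇒∣m+n (2∣n+n (degree G zero)) (handshake (deleteFirstVertex G)))

classGraph : {m : ℕ} → Graph v → (Fin v → Fin m) → Fin m → Graph v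
classGraph G cls i = induced G (λ x → cls x == i)

module _ {m : ℕ} (G : Graph v) (cls : Fin v → Fin m) (R : Fin m → Fin m → ℕ)
         (equitable : IsEquitable G cls R) (i : Fin m) where

  degree-classGraph : ∀ x → degree (classGraph G cls i) x ≡ (if cls x == i then R i i else 0)
  degree-classGraph x with cls x ≟ i
  ... | yes cls-x≡i = trans (equitable x i) (cong (λ c → R c i) cls-x≡i)
  ... | no  _       = count-false {v}

  sum-degree-classGraph : sum (degree (classGraph G cls i)) ≡ count (λ x → cls x == i) * R i i
  sum-degree-classGraph =
    trans (sum-cong-≗ degree-classGraph) (sum-if (λ x → cls x == i) (R i i))

2∤m⇒2∣m*n⇒2∣n : ∀ {m n} → ¬ (2 ∣ m) → 2 ∣ m * n → 2 ∣ n
2∤m⇒2∣m*n⇒2∣n {m} {n} 2∤m 2∣mn with euclidsLemma m n (from-yes (prime? 2)) 2∣mn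
... | inj₁ 2∣m = contradiction 2∣m 2∤m
... | inj₂ 2∣n = 2∣n

lemma2 : ∀ {v : ℕ} (G : Graph v) (k λ₁ λ₂ m n : ℕ) (cls : Fin v → Fin m)
           (R : Fin m → Fin m → ℕ) →
           IsDDG G k λ₁ λ₂ m n cls → ¬ (2 ∣ n) → IsEquitable G cls R →
           ∀ (i : Fin m) → 2 ∣ R i i
lemma2 G k λ₁ λ₂ m n cls R ddg n-odd equitable i = 2∤m⇒2∣m*n⇒2∣n n-odd 2∣n*rᵢᵢ
  where
  2∣n*rᵢᵢ : 2 ∣ n * R i i
  2∣n*rᵢᵢ = subst (λ c → 2 ∣ c * R i i) (IsDDG.classSize ddg i)
    (subst (2 ∣_) (sum-degree-classGraph G cls R equitable i) (handshake (classGraph G cls i)))
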